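{- Let $\mathtt{C}$ be a one-hole $\lambda^{\#}$-context, $\ell$ a label, $x$ a variable, $t$ a $\lambda^{\#}$-term and $\vec{s}$ a finite list of $\lambda^{\#}$-terms. If $\mathtt{C}[(\lambda^{\ell}x.t)\vec{s}]$ is a correct term and the judgment $\Gamma \vdash \mathtt{C}[(\lambda^{\ell}x.t)\vec{s}] : \mathcal{A}$ is derivable, then $\mathtt{C}[t\{x:=\vec{s}\}]$ is a correct term and $\Gamma \vdash \mathtt{C}[t\{x:=\vec{s}\}] : \mathcal{A}$ is derivable.
   Context: The distributive $\lambda$-calculus $\lambda^{\#}$. Fix a denumerable set of labels $\ell,\ell',\dots$ and denumerably many base types $\alpha,\beta,\dots$. Types: $\mathcal{A} ::= \alpha^{\ell} \mid \mathcal{M}\xrightarrow{\ell}\mathcal{A}$, where $\mathcal{M}=[\mathcal{A}_1,\dots,\mathcal{A}_n]$ ($n\ge 0$) is a finite multiset of types; $\ell$ is called the external label of $\alpha^\ell$ and of $\mathcal{M}\xrightarrow{\ell}\mathcal{A}$. A typing context $\Gamma$ is a partial map with finite domain from variables to multisets of types; $\Gamma+\Delta$ is the pointwise multiset sum ($(\Gamma+\Delta)(x)=\Gamma(x)+\Delta(x)$ if both defined, otherwise whichever is defined), and $\Gamma\oplus\Delta$ denotes $\Gamma+\Delta$ when the domains are disjoint. Terms: $t ::= x^{\mathcal{A}} \mid \lambda^{\ell}x.t \mid t[s_1,\dots,s_n]$ with $n\ge 0$ (the arguments form a finite list). Typing rules: (var) $x:[\mathcal{A}]\vdash x^{\mathcal{A}}:\mathcal{A}$;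 (lam) from $\Gamma\oplus(x:\mathcal{M})\vdash t:\mathcal{B}$ infer $\Gamma\vdash \lambda^{\ell}x.t:\mathcal{M}\xrightarrow{\ell}\mathcal{B}$; (app) from $\Gamma\vdash t:[\mathcal{B}_1,\dots,\mathcal{B}_n]\xrightarrow{\ell}\mathcal{A}$ and $\Delta_i\vdash s_i:\mathcal{B}_i$ for $i=1..n$ infer $\Gamma+\Delta_1+\dots+\Delta_n\vdash t[s_1,\dots,s_n]:\mathcal{A}$. A multiset of types is sequential if its elements have pairwise distinct external labels; a context $\Gamma$ is sequential if every $\Gamma(x)$ is. A type occurs in another if it is a subformula of it; it occurs in a multiset or context if it occurs in one of its members. A term $t$ is correct if it is typable and: (i) any two lambdas at different positions of $t$ carry different labels; (ii) every subterm of $t$ has a sequential typing context; (iii) for every subterm $s$ of $t$ with $\Gamma\vdash s:\mathcal{A}$, every type $\mathcal{M}\xrightarrow{\ell}\mathcal{B}$ occurring in $\Gamma$ or in $\mathcal{A}$ has $\mathcal{M}$ sequential. Substitution: for correct $t$ and a list $\vec{s}=[s_1,\dots,s_n]$ of correct terms such that the multiset of types of the free occurrences of $x$ in $t$ equals the multiset of types of $s_1,\dots,s_n$, $t\{x:=\vec{s}\}$ is defined by $x^{\mathcal{A}}\{x:=[s]\}=s$; $y^{\mathcal{A}}\{x:=[\,]\}=y^{\mathcal{A}}$ for $y\neq x$; $(\lambda^{\ell}y.u)\{x:=\vec{s}\}=\lambda^{\ell}y.(u\{x:=\vec{s}\})$ for $y\ne x$, $y$ not free in $\vec{s}$; $(u_0[u_1,\dots,u_m])\{x:=\vec{s}\}=u_0\{x:=\vec{s}_0\}[u_1\{x:=\vec{s}_1\},\dots,u_m\{x:=\vec{s}_m\}]$,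 where $(\vec{s}_0,\dots,\vec{s}_m)$ is a partition of $\vec{s}$ (lists whose concatenation is a permutation of $\vec{s}$) such that for each $j$ the types of the free occurrences of $x$ in $u_j$ coincide, as a multiset, with the types of $\vec s_j$ (the result does not depend on the choice). A context $\mathtt{C}$ is a term with one occurrence of a hole $\Box$; $\mathtt{C}[t]$ is capturing replacement of the hole by $t$. -}

module Defs where

open import Data.Nat using (ℕ; zero; suc; _<_; _≡ᵇ_; _<ᵇ_; pred)
open import Data.Bool using (if_then_else_)
open import Data.List using (List; []; _∷_; _++_; map; concat)
open import Data.List.Relation.Unary.Any using (Any)
open import Data.List.Relation.Unary.Unique.Propositional using (Unique)
open import Data.List.Relation.Binary.Pointwise using (Pointwise)
open import Data.List.Relation.Binary.Permutation.Homogeneous using (Permutation)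
import Data.List.Relation.Binary.Permutation.Propositional as PermProp
open import Data.Product using (Σ; _×_; ∃)
open import Data.Sum using (_⊎_)
open import Relation.Binary.PropositionalEquality using (_≡_)

-- Types.  Base types and labels are natural numbers.
-- A multiset of types is represented by a list, considered up to
-- permutation (and, recursively, up to type equivalence _≈ᵗ_).

Label : Set
Label = ℕ

data Ty : Set where
  base : ℕ → Label → Ty
  arr  : List Ty → Label → Ty → Ty

data _≈ᵗ_ : Ty → Ty → Set where
  base : ∀ {a l} → base a l ≈ᵗ base a l
  arr  : ∀ {M N l A B} → Permutation _≈ᵗ_ M N → A ≈ᵗ B → arr M l A ≈ᵗ arr N l B

_≈ₘ_ : List Ty → List Ty → Set
_≈ₘ_ = Permutation _≈ᵗ_

extLabel : Ty → Label
extLabel (base _ l) = l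
extLabel (arr _ l _) = l

Sequential : List Ty → Set
Sequential M = Unique (map extLabel M)

data _⊴_ (C : Ty) : Ty → Set where
  here : C ⊴ C
  dom  : ∀ {M l B} → Any (C ⊴_) M → C ⊴ arr M l B
  cod  : ∀ {M l B} → C ⊴ B → C ⊴ arr M l B

-- Terms (variables as de Bruijn indices)

data Term : Set where
  var : ℕ → Ty → Term
  lam : Label → Term → Term
  app : Term → List Term → Term

-- Typing contexts: map variables to multisets; [] = not in domain.
Ctx : Set
Ctx = ℕ → List Ty

∅ : Ctx
∅ _ = []

_+ᶜ_ : Ctx → Ctx → Ctx
(Γ +ᶜ Δ) n = Γ n ++ Δ n

single : ℕ → List Ty → Ctx
single k M n = if n ≡ᵇ k then M else []

_≈ᶜ_ : Ctx → Ctx → Set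
Γ ≈ᶜ Δ = ∀ n → Γ n ≈ₘ Δ n

-- Typing rules (on representatives)
mutual
  data _⊢_∶_ : Ctx → Term → Ty → Set where
    var : ∀ {k A} → single k (A ∷ []) ⊢ var k A ∶ A
    lam : ∀ {Δ t B l} → Δ ⊢ t ∶ B →
          (λ n → Δ (suc n)) ⊢ lam l t ∶ arr (Δ 0) l B
    app : ∀ {Γ Δ t ss M l A Bs} → Γ ⊢ t ∶ arr M l A → Args Δ ss Bs →
          M ≈ₘ Bs → (Γ +ᶜ Δ) ⊢ app t ss ∶ A

  data Args : Ctx → List Term → List Ty → Set where
    []  : Args ∅ [] []
    _∷_ : ∀ {Γ Δ s ss B Bs} → Γ ⊢ s ∶ B → Args Δ ss Bs →
          Args (Γ +ᶜ Δ) (s ∷ ss) (B ∷ Bs)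

-- The judgment Γ ⊢ t : A of the paper (contexts/types up to multiset equality)
Derivable : Ctx → Term → Ty → Set
Derivable Γ t A = Σ Ctx λ Γ' → Σ Ty λ A' → (Γ' ⊢ t ∶ A') × Γ ≈ᶜ Γ' × A ≈ᵗ A'

Typable : Term → Set
Typable t = Σ Ctx λ Γ → Σ Ty λ A → Derivable Γ t A

SeqCtx : Ctx → Set
SeqCtx Γ = ∀ x → Sequential (Γ x)

data _⊑_ (s : Term) : Term → Set where
  refl  : s ⊑ s
  inLam : ∀ {l t} → s ⊑ t → s ⊑ lam l t
  inFun : ∀ {t us} → s ⊑ t → s ⊑ app t us
  inArg : ∀ {t u us} → Any (_≡ u) us → s ⊑ u → s ⊑ app t us

mutual
  lamLabels : Term → List Label
  lamLabels (var _ _) = []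
  lamLabels (lam l t) = l ∷ lamLabels t
  lamLabels (app t ss) = lamLabels t ++ lamLabelsL ss

  lamLabelsL : List Term → List Label
  lamLabelsL [] = []
  lamLabelsL (s ∷ ss) = lamLabels s ++ lamLabelsL ss

Correct : Term → Set
Correct t =
  Typable t ×
  Unique (lamLabels t) ×
  (∀ s → s ⊑ t → ∀ Γ A → Derivable Γ s A →
     SeqCtx Γ ×
     (∀ M l B → (Σ ℕ (λ x → Any (arr M l B ⊴_) (Γ x)) ⊎ (arr M l B ⊴ A)) →
        Sequential M))

mutual
  shift : ℕ → Term → Term
  shift c (var k A) = if k <ᵇ c then var k A else var (suc k) A
  shift c (lam l t) = lam l (shift (suc c) t)
  shift c (app t ss) = app (shift c t) (shiftL c ss)

  shiftL : ℕ → List Term → List Term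
  shiftL c [] = []
  shiftL c (s ∷ ss) = shift c s ∷ shiftL c ss

mutual
  fvTypes : ℕ → Term → List Ty
  fvTypes j (var k A) = if k ≡ᵇ j then A ∷ [] else []
  fvTypes j (lam l t) = fvTypes (suc j) t
  fvTypes j (app t ss) = fvTypes j t ++ fvTypesL j ss

  fvTypesL : ℕ → List Term → List Ty
  fvTypesL j [] = []
  fvTypesL j (s ∷ ss) = fvTypes j s ++ fvTypesL j ss

Match : ℕ → List Term → Term → Set
Match j ss u = Σ (List Ty) λ Bs →
  Pointwise (λ s B → Σ Ctx λ Δ → Derivable Δ s B) ss Bs × fvTypes j u ≈ₘ Bs

-- Linear substitution u{j := ss} ≐ r, as a relation (partitions are a choice)
mutual
  data Subst (j : ℕ) : List Term → Term → Term → Set where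
    var-hit : ∀ {s A} → Subst j (s ∷ []) (var j A) s
    var-lt  : ∀ {k A} → k < j → Subst j [] (var k A) (var k A)
    var-gt  : ∀ {k A} → j < k → Subst j [] (var k A) (var (pred k) A)
    lam     : ∀ {ss l u r} → Subst (suc j) (shiftL 0 ss) u r →
              Subst j ss (lam l u) (lam l r)
    app     : ∀ {ss u0 us r0 rs} (ss0 : List Term) (sss : List (List Term)) →
              ss PermProp.↭ (ss0 ++ concat sss) →
              Match j ss0 u0 → Subst j ss0 u0 r0 → SubstL j sss us rs →
              Subst j ss (app u0 us) (app r0 rs)

  data SubstL (j : ℕ) : List (List Term) → List Term → List Term → Set where
    []  : SubstL j [] [] []
    _∷_ : ∀ {ssk sss u us r rs} → Match j ssk u × Subst j ssk u r →
          SubstL j sss us rs → SubstL j (ssk ∷ sss) (u ∷ us) (r ∷ rs)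

_[_≔_]≐_ : Term → ℕ → List Term → Term → Set
t [ j ≔ ss ]≐ r = Match j ss t × Subst j ss t r

data Hole : Set where
  □    : Hole
  lam  : Label → Hole → Hole
  appL : Hole → List Term → Hole
  appR : Term → List Term → Hole → List Term → Hole

plug : Hole → Term → Term
plug □ t = t
plug (lam l C) t = lam l (plug C t)
plug (appL C ss) t = app (plug C t) ss
plug (appR u ss1 C ss2) t = app u (ss1 ++ plug C t ∷ ss2)

-- Typing in λ# is syntax directed and linear: a term has at most one derivation, and the context of
-- t{x := s⃗} is that of t with x removed, plus the contexts of the sᵢ (one copy each). So the reduct
-- of a typed redex is typed in a permutation of the redex's context, with an equivalent type, and
-- this propagates through any one-hole context. Correctness is inherited in the same way: a subterm
-- of C[t{x := s⃗}] is either above the hole (same judgement up to permutation), a subterm of some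
-- (shifted) sᵢ, or u{x := s⃗′} for a subterm u of t, and then its context is part of the sequential
-- context of the redex occurrence. Finally the reduct has the lambda labels of the redex minus ℓ.
module Submission where

open import Algebra using (CommutativeMonoid)
import Algebra.Properties.CommutativeSemigroup
open import Data.Bool using (true; false; T)
open import Data.List using (List; []; _∷_; _++_; map; concat)
open import Data.List.Properties using (map-++; ++-assoc; ++-identityʳ)
open import Data.List.Relation.Binary.Permutation.Homogeneous using (refl; prep; swap; trans)
open import Data.List.Relation.Binary.Permutation.Propositional as ↭
  using (_↭_; ↭-sym; ↭-refl; ↭-reflexive; ↭-trans; ↭⇒↭ₛ′; ↭⇒↭ₛ)
open import Data.List.Relation.Binary.Permutation.Propositional.Properties
  using (++⁺; ++⁺ˡ; ++⁺ʳ; shifts; ++-comm; ∷↭∷ʳ; All-resp-↭; ++-commutativeMonoid)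
import Data.List.Relation.Binary.Permutation.Setoid.Properties as ↭ₛ
open import Data.List.Relation.Binary.Pointwise as PW using (Pointwise; []; _∷_)
open import Data.List.Relation.Unary.All as All using (All; []; _∷_)
import Data.List.Relation.Unary.All.Properties as All
open import Data.List.Relation.Unary.Any as Any using (Any; here; there)
import Data.List.Relation.Unary.Any.Properties as Any
open import Data.List.Relation.Unary.Unique.Propositional using (Unique; []; _∷_)
open import Data.Nat using (ℕ; zero; suc; _<_; _≡ᵇ_; _<ᵇ_; pred; s<s)
open import Data.Nat.Properties using (≡ᵇ⇒≡; <-cmp)
open import Data.Product using (Σ; _×_; _,_; ∃; ∃₂)
open import Data.Sum using (_⊎_; inj₁; inj₂)
open import Function using (_∘_)
open import Relation.Binary using (Setoid; IsEquivalence)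
open import Relation.Binary.Definitions using (tri<; tri≈; tri>)
open import Relation.Binary.PropositionalEquality as ≡ using (_≡_; _≗_; cong; cong₂)
open import Relation.Nullary using (contradiction)

open import Defs

-- Types up to multiset equality

mutual
  ≈ᵗ-refl : ∀ {A} → A ≈ᵗ A
  ≈ᵗ-refl {base _ _} = base
  ≈ᵗ-refl {arr _ _ _} = arr (refl ≋ᵗ-refl) ≈ᵗ-refl

  ≋ᵗ-refl : ∀ {M} → Pointwise _≈ᵗ_ M M
  ≋ᵗ-refl {[]} = []
  ≋ᵗ-refl {_ ∷ _} = ≈ᵗ-refl ∷ ≋ᵗ-refl

mutual
  ≈ᵗ-sym : ∀ {A B} → A ≈ᵗ B → B ≈ᵗ A
  ≈ᵗ-sym base = base
  ≈ᵗ-sym (arr p q) = arr (≈ₘ-sym p) (≈ᵗ-sym q)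

  ≈ₘ-sym : ∀ {M N} → M ≈ₘ N → N ≈ₘ M
  ≈ₘ-sym (refl ps) = refl (≋ᵗ-sym ps)
  ≈ₘ-sym (prep e p) = prep (≈ᵗ-sym e) (≈ₘ-sym p)
  ≈ₘ-sym (swap e f p) = swap (≈ᵗ-sym f) (≈ᵗ-sym e) (≈ₘ-sym p)
  ≈ₘ-sym (trans p q) = trans (≈ₘ-sym q) (≈ₘ-sym p)

  ≋ᵗ-sym : ∀ {M N} → Pointwise _≈ᵗ_ M N → Pointwise _≈ᵗ_ N M
  ≋ᵗ-sym [] = []
  ≋ᵗ-sym (e ∷ es) = ≈ᵗ-sym e ∷ ≋ᵗ-sym es

≈ᵗ-trans : ∀ {A B C} → A ≈ᵗ B → B ≈ᵗ C → A ≈ᵗ C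
≈ᵗ-trans base base = base
≈ᵗ-trans (arr p q) (arr p′ q′) = arr (trans p p′) (≈ᵗ-trans q q′)

≈ᵗ-isEquivalence : IsEquivalence _≈ᵗ_
≈ᵗ-isEquivalence = record { refl = ≈ᵗ-refl ; sym = ≈ᵗ-sym ; trans = ≈ᵗ-trans }

Ty-setoid : Setoid _ _
Ty-setoid = record { isEquivalence = ≈ᵗ-isEquivalence }

module ≈ₘ = ↭ₛ Ty-setoid

≈ₘ-refl : ∀ {M} → M ≈ₘ M
≈ₘ-refl = refl ≋ᵗ-refl

≡⇒≈ₘ : ∀ {M N} → M ≡ N → M ≈ₘ N
≡⇒≈ₘ ≡.refl = ≈ₘ-refl

↭⇒≈ₘ : ∀ {M N} → M ↭ N → M ≈ₘ N
↭⇒≈ₘ = ↭⇒↭ₛ′ ≈ᵗ-isEquivalence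

≈ₘ-[]-inv : ∀ {N} → [] ≈ₘ N → N ≡ []
≈ₘ-[]-inv (refl []) = ≡.refl
≈ₘ-[]-inv (trans p q) with ≡.refl ← ≈ₘ-[]-inv p = ≈ₘ-[]-inv q

≈ₘ-[-]-inv : ∀ {A N} → (A ∷ []) ≈ₘ N → ∃ λ B → N ≡ B ∷ [] × A ≈ᵗ B
≈ₘ-[-]-inv (refl (e ∷ [])) = _ , ≡.refl , e
≈ₘ-[-]-inv (prep e p) with ≡.refl ← ≈ₘ-[]-inv p = _ , ≡.refl , e
≈ₘ-[-]-inv (trans p q)
  with _ , ≡.refl , e ← ≈ₘ-[-]-inv p
  with _ , ≡.refl , e′ ← ≈ₘ-[-]-inv q = _ , ≡.refl , ≈ᵗ-trans e e′

-- Sequentiality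

Unique-resp-↭ : ∀ {xs ys : List ℕ} → xs ↭ ys → Unique xs → Unique ys
Unique-resp-↭ p = ↭ₛ.Unique-resp-↭ (≡.setoid ℕ) (↭⇒↭ₛ p)

Unique-++⁻ˡ : ∀ (xs : List ℕ) {ys} → Unique (xs ++ ys) → Unique xs
Unique-++⁻ˡ [] _ = []
Unique-++⁻ˡ (x ∷ xs) (x∉ ∷ u) = All.++⁻ˡ xs x∉ ∷ Unique-++⁻ˡ xs u

extLabel-resp-≈ᵗ : ∀ {A B} → A ≈ᵗ B → extLabel A ≡ extLabel B
extLabel-resp-≈ᵗ base = ≡.refl
extLabel-resp-≈ᵗ (arr _ _) = ≡.refl

Sequential-resp-≈ₘ : ∀ {M N} → M ≈ₘ N → Sequential M → Sequential N
Sequential-resp-≈ₘ p = ↭ₛ.Unique-resp-↭ (≡.setoid ℕ) (≈ₘ.map⁺ (≡.setoid ℕ) extLabel-resp-≈ᵗ p)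

Sequential-++⁻ˡ : ∀ M {N} → Sequential (M ++ N) → Sequential M
Sequential-++⁻ˡ M {N} s = Unique-++⁻ˡ (map extLabel M) (≡.subst Unique (map-++ extLabel M N) s)

data DeepSeq : Ty → Set where
  base : ∀ {a l} → DeepSeq (base a l)
  arr  : ∀ {M l B} → Sequential M → All DeepSeq M → DeepSeq B → DeepSeq (arr M l B)

DeepSeqs : List Ty → Set
DeepSeqs = All DeepSeq

mutual
  DeepSeq-resp-≈ᵗ : ∀ {A B} → A ≈ᵗ B → DeepSeq A → DeepSeq B
  DeepSeq-resp-≈ᵗ base base = base
  DeepSeq-resp-≈ᵗ (arr p q) (arr s ds d) =
    arr (Sequential-resp-≈ₘ p s) (DeepSeqs-resp-≈ₘ p ds) (DeepSeq-resp-≈ᵗ q d)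

  DeepSeqs-resp-≈ₘ : ∀ {M N} → M ≈ₘ N → DeepSeqs M → DeepSeqs N
  DeepSeqs-resp-≈ₘ (refl ps) ds = DeepSeqs-resp-≋ᵗ ps ds
  DeepSeqs-resp-≈ₘ (prep e p) (d ∷ ds) = DeepSeq-resp-≈ᵗ e d ∷ DeepSeqs-resp-≈ₘ p ds
  DeepSeqs-resp-≈ₘ (swap e f p) (d ∷ d′ ∷ ds) =
    DeepSeq-resp-≈ᵗ f d′ ∷ DeepSeq-resp-≈ᵗ e d ∷ DeepSeqs-resp-≈ₘ p ds
  DeepSeqs-resp-≈ₘ (trans p q) ds = DeepSeqs-resp-≈ₘ q (DeepSeqs-resp-≈ₘ p ds)

  DeepSeqs-resp-≋ᵗ : ∀ {M N} → Pointwise _≈ᵗ_ M N → DeepSeqs M → DeepSeqs N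
  DeepSeqs-resp-≋ᵗ [] [] = []
  DeepSeqs-resp-≋ᵗ (e ∷ es) (d ∷ ds) = DeepSeq-resp-≈ᵗ e d ∷ DeepSeqs-resp-≋ᵗ es ds

ArrowsSequential : Ty → Set
ArrowsSequential C = ∀ M l B → arr M l B ⊴ C → Sequential M

ArrowsSequentialᴸ : List Ty → Set
ArrowsSequentialᴸ Cs = ∀ M l B → Any (arr M l B ⊴_) Cs → Sequential M

mutual
  DeepSeq⇒ArrowsSequential : ∀ {C} → DeepSeq C → ArrowsSequential C
  DeepSeq⇒ArrowsSequential (arr s _ _) M l B here = s
  DeepSeq⇒ArrowsSequential (arr _ ds _) M l B (dom h) = DeepSeqs⇒ArrowsSequentialᴸ ds M l B h
  DeepSeq⇒ArrowsSequential (arr _ _ d) M l B (cod h) = DeepSeq⇒ArrowsSequential d M l B h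

  DeepSeqs⇒ArrowsSequentialᴸ : ∀ {Cs} → DeepSeqs Cs → ArrowsSequentialᴸ Cs
  DeepSeqs⇒ArrowsSequentialᴸ (d ∷ _) M l B (here h) = DeepSeq⇒ArrowsSequential d M l B h
  DeepSeqs⇒ArrowsSequentialᴸ (_ ∷ ds) M l B (there h) = DeepSeqs⇒ArrowsSequentialᴸ ds M l B h

mutual
  ArrowsSequential⇒DeepSeq : ∀ C → ArrowsSequential C → DeepSeq C
  ArrowsSequential⇒DeepSeq (base _ _) _ = base
  ArrowsSequential⇒DeepSeq (arr M l B) seq =
    arr (seq M l B here)
        (ArrowsSequentialᴸ⇒DeepSeqs M λ M′ l′ B′ h → seq M′ l′ B′ (dom h))
        (ArrowsSequential⇒DeepSeq B λ M′ l′ B′ h → seq M′ l′ B′ (cod h))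

  ArrowsSequentialᴸ⇒DeepSeqs : ∀ Cs → ArrowsSequentialᴸ Cs → DeepSeqs Cs
  ArrowsSequentialᴸ⇒DeepSeqs [] _ = []
  ArrowsSequentialᴸ⇒DeepSeqs (C ∷ Cs) seq =
    ArrowsSequential⇒DeepSeq C (λ M l B h → seq M l B (here h)) ∷
    ArrowsSequentialᴸ⇒DeepSeqs Cs (λ M l B h → seq M l B (there h))

-- Contexts

_↭ᶜ_ : Ctx → Ctx → Set
Γ ↭ᶜ Δ = ∀ n → Γ n ↭ Δ n

↭ᶜ-refl : ∀ {Γ} → Γ ↭ᶜ Γ
↭ᶜ-refl _ = ↭-refl

↭ᶜ-sym : ∀ {Γ Δ} → Γ ↭ᶜ Δ → Δ ↭ᶜ Γ
↭ᶜ-sym p = ↭-sym ∘ p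

↭ᶜ-trans : ∀ {Γ Δ E} → Γ ↭ᶜ Δ → Δ ↭ᶜ E → Γ ↭ᶜ E
↭ᶜ-trans p q n = ↭-trans (p n) (q n)

≗⇒↭ᶜ : ∀ {Γ Δ} → Γ ≗ Δ → Γ ↭ᶜ Δ
≗⇒↭ᶜ e n = ↭-reflexive (e n)

↭ᶜ-+ᶜ : ∀ {Γ Γ′ Δ Δ′} → Γ ↭ᶜ Γ′ → Δ ↭ᶜ Δ′ → (Γ +ᶜ Δ) ↭ᶜ (Γ′ +ᶜ Δ′)
↭ᶜ-+ᶜ Γ↭ Δ↭ n = ++⁺ (Γ↭ n) (Δ↭ n)

+ᶜ-assoc : ∀ Γ Δ E → ((Γ +ᶜ Δ) +ᶜ E) ≗ (Γ +ᶜ (Δ +ᶜ E))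
+ᶜ-assoc Γ Δ E n = ++-assoc (Γ n) (Δ n) (E n)

≡ᵇ-refl : ∀ m → (m ≡ᵇ m) ≡ true
≡ᵇ-refl zero = ≡.refl
≡ᵇ-refl (suc m) = ≡ᵇ-refl m

≡ᵇ-sym : ∀ m n → (m ≡ᵇ n) ≡ (n ≡ᵇ m)
≡ᵇ-sym zero zero = ≡.refl
≡ᵇ-sym zero (suc n) = ≡.refl
≡ᵇ-sym (suc m) zero = ≡.refl
≡ᵇ-sym (suc m) (suc n) = ≡ᵇ-sym m n

single-self : ∀ j M → single j M j ≡ M
single-self j M rewrite ≡ᵇ-refl j = ≡.refl

-- shiftCtx c Γ is the context of shift c t when Γ is that of t; dropCtx j Γ removes variable j.
shiftCtx : ℕ → Ctx → Ctx
shiftCtx zero Γ zero = []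
shiftCtx zero Γ (suc n) = Γ n
shiftCtx (suc c) Γ zero = Γ zero
shiftCtx (suc c) Γ (suc n) = shiftCtx c (Γ ∘ suc) n

dropCtx : ℕ → Ctx → Ctx
dropCtx zero Γ n = Γ (suc n)
dropCtx (suc j) Γ zero = Γ zero
dropCtx (suc j) Γ (suc n) = dropCtx j (Γ ∘ suc) n

shiftCtx-∅ : ∀ c → shiftCtx c ∅ ≗ ∅
shiftCtx-∅ zero zero = ≡.refl
shiftCtx-∅ zero (suc n) = ≡.refl
shiftCtx-∅ (suc c) zero = ≡.refl
shiftCtx-∅ (suc c) (suc n) = shiftCtx-∅ c n

shiftCtx-+ᶜ : ∀ c Γ Δ → shiftCtx c (Γ +ᶜ Δ) ≗ shiftCtx c Γ +ᶜ shiftCtx c Δ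
shiftCtx-+ᶜ zero Γ Δ zero = ≡.refl
shiftCtx-+ᶜ zero Γ Δ (suc n) = ≡.refl
shiftCtx-+ᶜ (suc c) Γ Δ zero = ≡.refl
shiftCtx-+ᶜ (suc c) Γ Δ (suc n) = shiftCtx-+ᶜ c (Γ ∘ suc) (Δ ∘ suc) n

shiftCtx-single-< : ∀ c k M → (k <ᵇ c) ≡ true → shiftCtx c (single k M) ≗ single k M
shiftCtx-single-< (suc c) zero M _ zero = ≡.refl
shiftCtx-single-< (suc c) zero M _ (suc n) = shiftCtx-∅ c n
shiftCtx-single-< (suc c) (suc k) M _ zero = ≡.refl
shiftCtx-single-< (suc c) (suc k) M k<c (suc n) = shiftCtx-single-< c k M k<c n

shiftCtx-single-≥ : ∀ c k M → (k <ᵇ c) ≡ false → shiftCtx c (single k M) ≗ single (suc k) M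
shiftCtx-single-≥ zero k M _ zero = ≡.refl
shiftCtx-single-≥ zero k M _ (suc n) = ≡.refl
shiftCtx-single-≥ (suc c) (suc k) M _ zero = ≡.refl
shiftCtx-single-≥ (suc c) (suc k) M k≥c (suc n) = shiftCtx-single-≥ c k M k≥c n

shiftCtx-preserves : ∀ (P : List Ty → Set) c {Γ} → P [] → (∀ n → P (Γ n)) → ∀ n → P (shiftCtx c Γ n)
shiftCtx-preserves P zero p[] pΓ zero = p[]
shiftCtx-preserves P zero p[] pΓ (suc n) = pΓ n
shiftCtx-preserves P (suc c) p[] pΓ zero = pΓ zero
shiftCtx-preserves P (suc c) p[] pΓ (suc n) = shiftCtx-preserves P c p[] (pΓ ∘ suc) n

dropCtx-∅ : ∀ j → dropCtx j ∅ ≗ ∅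
dropCtx-∅ zero n = ≡.refl
dropCtx-∅ (suc j) zero = ≡.refl
dropCtx-∅ (suc j) (suc n) = dropCtx-∅ j n

dropCtx-+ᶜ : ∀ j Γ Δ → dropCtx j (Γ +ᶜ Δ) ≗ dropCtx j Γ +ᶜ dropCtx j Δ
dropCtx-+ᶜ zero Γ Δ n = ≡.refl
dropCtx-+ᶜ (suc j) Γ Δ zero = ≡.refl
dropCtx-+ᶜ (suc j) Γ Δ (suc n) = dropCtx-+ᶜ j (Γ ∘ suc) (Δ ∘ suc) n

dropCtx-single-≡ : ∀ j M → dropCtx j (single j M) ≗ ∅
dropCtx-single-≡ zero M n = ≡.refl
dropCtx-single-≡ (suc j) M zero = ≡.refl
dropCtx-single-≡ (suc j) M (suc n) = dropCtx-single-≡ j M n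

dropCtx-single-< : ∀ j k M → k < j → dropCtx j (single k M) ≗ single k M
dropCtx-single-< (suc j) zero M _ zero = ≡.refl
dropCtx-single-< (suc j) zero M _ (suc n) = dropCtx-∅ j n
dropCtx-single-< (suc j) (suc k) M _ zero = ≡.refl
dropCtx-single-< (suc j) (suc k) M (s<s k<j) (suc n) = dropCtx-single-< j k M k<j n

dropCtx-single-> : ∀ j k M → j < k → dropCtx j (single k M) ≗ single (pred k) M
dropCtx-single-> zero (suc k) M _ n = ≡.refl
dropCtx-single-> (suc j) (suc zero) M (s<s ()) n
dropCtx-single-> (suc j) (suc (suc k)) M _ zero = ≡.refl
dropCtx-single-> (suc j) (suc (suc k)) M (s<s j<k) (suc n) = dropCtx-single-> j (suc k) M j<k n

dropCtx-preserves : ∀ (P : List Ty → Set) j {Γ} → (∀ n → P (Γ n)) → ∀ n → P (dropCtx j Γ n)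
dropCtx-preserves P zero pΓ n = pΓ (suc n)
dropCtx-preserves P (suc j) pΓ zero = pΓ zero
dropCtx-preserves P (suc j) pΓ (suc n) = dropCtx-preserves P j (pΓ ∘ suc) n

dropCtx-under-binder : ∀ j Γ {Δ Δ′} → Δ′ ≗ shiftCtx 0 Δ →
                       (dropCtx (suc j) Γ +ᶜ Δ′) zero ≡ Γ zero ×
                       (∀ n → (dropCtx (suc j) Γ +ᶜ Δ′) (suc n) ≡ (dropCtx j (Γ ∘ suc) +ᶜ Δ) n)
dropCtx-under-binder j Γ Δ′≗ =
  ≡.trans (cong (Γ 0 ++_) (Δ′≗ 0)) (++-identityʳ (Γ 0)) ,
  λ n → cong (dropCtx j (Γ ∘ suc) n ++_) (Δ′≗ (suc n))

module ++-CommSemigroup {A : Set} =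
  Algebra.Properties.CommutativeSemigroup
    (CommutativeMonoid.commutativeSemigroup (++-commutativeMonoid {A = A}))
open ++-CommSemigroup using (interchange; xy∙z≈xz∙y)

dropCtx-regroup : ∀ j Γ Δ Δ₁ Δ₂ {E} → E ↭ᶜ (Δ₁ +ᶜ Δ₂) →
                  (dropCtx j (Γ +ᶜ Δ) +ᶜ E) ↭ᶜ ((dropCtx j Γ +ᶜ Δ₁) +ᶜ (dropCtx j Δ +ᶜ Δ₂))
dropCtx-regroup j Γ Δ Δ₁ Δ₂ {E} E↭ n = begin
  dropCtx j (Γ +ᶜ Δ) n ++ E n                          ≡⟨ cong (_++ E n) (dropCtx-+ᶜ j Γ Δ n) ⟩
  (dropCtx j Γ n ++ dropCtx j Δ n) ++ E n              ↭⟨ ++⁺ˡ (dropCtx j Γ n ++ dropCtx j Δ n) (E↭ n) ⟩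
  (dropCtx j Γ n ++ dropCtx j Δ n) ++ (Δ₁ n ++ Δ₂ n)  ↭⟨ interchange (dropCtx j Γ n) _ _ _ ⟩
  (dropCtx j Γ n ++ Δ₁ n) ++ (dropCtx j Δ n ++ Δ₂ n)  ∎
  where open ↭.PermutationReasoning

SeqCtx-split : ∀ {Γ} Γ₁ Γ₂ → Γ ↭ᶜ (Γ₁ +ᶜ Γ₂) → SeqCtx Γ → SeqCtx Γ₁ × SeqCtx Γ₂
SeqCtx-split Γ₁ Γ₂ Γ↭ sq =
  (λ n → Sequential-++⁻ˡ (Γ₁ n) (Sequential-resp-≈ₘ (↭⇒≈ₘ (Γ↭ n)) (sq n))) ,
  (λ n → Sequential-++⁻ˡ (Γ₂ n) (Sequential-resp-≈ₘ (↭⇒≈ₘ (↭-trans (Γ↭ n) (++-comm (Γ₁ n) (Γ₂ n)))) (sq n)))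

-- Typing and substitution

mutual
  ⊢-unique : ∀ {Γ Γ′ w A A′} → Γ ⊢ w ∶ A → Γ′ ⊢ w ∶ A′ → Γ ≗ Γ′ × A ≡ A′
  ⊢-unique var var = (λ _ → ≡.refl) , ≡.refl
  ⊢-unique (lam d) (lam d′) with Γ≗ , ≡.refl ← ⊢-unique d d′ = Γ≗ ∘ suc , cong (λ M → arr M _ _) (Γ≗ 0)
  ⊢-unique (app d as _) (app d′ as′ _) with Γ≗ , ≡.refl ← ⊢-unique d d′ | Δ≗ , _ ← Args-unique as as′ =
    (λ n → cong₂ _++_ (Γ≗ n) (Δ≗ n)) , ≡.refl

  Args-unique : ∀ {Δ Δ′ ss Bs Bs′} → Args Δ ss Bs → Args Δ′ ss Bs′ → Δ ≗ Δ′ × Bs ≡ Bs′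
  Args-unique [] [] = (λ _ → ≡.refl) , ≡.refl
  Args-unique (d ∷ as) (d′ ∷ as′) with Γ≗ , ≡.refl ← ⊢-unique d d′ | Δ≗ , ≡.refl ← Args-unique as as′ =
    (λ n → cong₂ _++_ (Γ≗ n) (Δ≗ n)) , ≡.refl

mutual
  fvTypes-⊢ : ∀ {Γ w A} → Γ ⊢ w ∶ A → ∀ j → fvTypes j w ≡ Γ j
  fvTypes-⊢ (var {k}) j rewrite ≡ᵇ-sym k j = ≡.refl
  fvTypes-⊢ (lam d) j = fvTypes-⊢ d (suc j)
  fvTypes-⊢ (app d as _) j = cong₂ _++_ (fvTypes-⊢ d j) (fvTypesL-Args as j)

  fvTypesL-Args : ∀ {Δ ss Bs} → Args Δ ss Bs → ∀ j → fvTypesL j ss ≡ Δ j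
  fvTypesL-Args [] j = ≡.refl
  fvTypesL-Args (d ∷ as) j = cong₂ _++_ (fvTypes-⊢ d j) (fvTypesL-Args as j)

Args-∈ : ∀ {Δ us Bs u} → Args Δ us Bs → Any (_≡ u) us → ∃₂ λ Γ A → Γ ⊢ u ∶ A
Args-∈ (d ∷ _) (here ≡.refl) = _ , _ , d
Args-∈ (_ ∷ as) (there u∈) = Args-∈ as u∈

⊢-⊑ : ∀ {Γ t A w} → Γ ⊢ t ∶ A → w ⊑ t → ∃₂ λ Γ′ A′ → Γ′ ⊢ w ∶ A′
⊢-⊑ d refl = _ , _ , d
⊢-⊑ (lam d) (inLam w⊑) = ⊢-⊑ d w⊑
⊢-⊑ (app d _ _) (inFun w⊑) = ⊢-⊑ d w⊑
⊢-⊑ (app _ as _) (inArg u∈ w⊑) with _ , _ , du ← Args-∈ as u∈ = ⊢-⊑ du w⊑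

mutual
  ⊢-shift : ∀ {Γ w A} c → Γ ⊢ w ∶ A → ∃ λ Γ′ → Γ′ ⊢ shift c w ∶ A × Γ′ ≗ shiftCtx c Γ
  ⊢-shift c (var {k} {A}) with k <ᵇ c in k<c
  ... | true = _ , var , λ n → ≡.sym (shiftCtx-single-< c k (A ∷ []) k<c n)
  ... | false = _ , var , λ n → ≡.sym (shiftCtx-single-≥ c k (A ∷ []) k<c n)
  ⊢-shift {A = arr _ l B} c (lam d) with Γ′ , d′ , Γ′≗ ← ⊢-shift (suc c) d =
    _ , ≡.subst (λ M → _ ⊢ _ ∶ arr M l B) (Γ′≗ 0) (lam d′) , Γ′≗ ∘ suc
  ⊢-shift c (app {Γ} {Δ} d as M≈) with _ , d′ , Γ′≗ ← ⊢-shift c d | _ , as′ , Δ′≗ ← Args-shift c as =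
    _ , app d′ as′ M≈ , λ n → ≡.trans (cong₂ _++_ (Γ′≗ n) (Δ′≗ n)) (≡.sym (shiftCtx-+ᶜ c Γ Δ n))

  Args-shift : ∀ {Δ ss Bs} c → Args Δ ss Bs → ∃ λ Δ′ → Args Δ′ (shiftL c ss) Bs × Δ′ ≗ shiftCtx c Δ
  Args-shift c [] = ∅ , [] , λ n → ≡.sym (shiftCtx-∅ c n)
  Args-shift c (_∷_ {Γ} {Δ} d as) with _ , d′ , Γ′≗ ← ⊢-shift c d | _ , as′ , Δ′≗ ← Args-shift c as =
    _ , d′ ∷ as′ , λ n → ≡.trans (cong₂ _++_ (Γ′≗ n) (Δ′≗ n)) (≡.sym (shiftCtx-+ᶜ c Γ Δ n))

Args-↭ : ∀ {Δ ss ss′ Bs} → Args Δ ss Bs → ss ↭ ss′ → ∃₂ λ Δ′ Bs′ → Args Δ′ ss′ Bs′ × Δ ↭ᶜ Δ′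
Args-↭ as ↭.refl = _ , _ , as , ↭ᶜ-refl
Args-↭ (_∷_ {Γ} d as) (↭.prep _ p) with _ , _ , as′ , Δ↭ ← Args-↭ as p =
  _ , _ , d ∷ as′ , λ n → ++⁺ˡ (Γ n) (Δ↭ n)
Args-↭ (_∷_ {Γ₁} d₁ (_∷_ {Γ₂} d₂ as)) (↭.swap _ _ p) with _ , _ , as′ , Δ↭ ← Args-↭ as p =
  _ , _ , d₂ ∷ d₁ ∷ as′ , λ n → ↭-trans (++⁺ˡ (Γ₁ n) (++⁺ˡ (Γ₂ n) (Δ↭ n))) (shifts (Γ₁ n) (Γ₂ n))
Args-↭ as (↭.trans p q)
  with _ , _ , as′ , Δ↭ ← Args-↭ as p
  with _ , _ , as″ , Δ′↭ ← Args-↭ as′ q = _ , _ , as″ , ↭ᶜ-trans Δ↭ Δ′↭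

record ArgsSplit (xs ys : List Term) (Δ : Ctx) (Bs : List Ty) : Set where
  constructor split
  field
    {Δˡ Δʳ} : Ctx
    {Bsˡ Bsʳ} : List Ty
    left : Args Δˡ xs Bsˡ
    right : Args Δʳ ys Bsʳ
    ctx : Δ ≗ Δˡ +ᶜ Δʳ
    tys : Bs ≡ Bsˡ ++ Bsʳ

Args-++⁻ : ∀ xs {ys Δ Bs} → Args Δ (xs ++ ys) Bs → ArgsSplit xs ys Δ Bs
Args-++⁻ [] as = split [] as (λ _ → ≡.refl) ≡.refl
Args-++⁻ (x ∷ xs) (_∷_ {Γ} d as) with split {Δˡ} {Δʳ} aˡ aʳ Δ≗ ≡.refl ← Args-++⁻ xs as =
  split (d ∷ aˡ) aʳ (λ n → ≡.trans (cong (Γ n ++_) (Δ≗ n)) (≡.sym (+ᶜ-assoc Γ Δˡ Δʳ n))) ≡.refl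

Args-++⁺ : ∀ {Δ₁ Δ₂ xs ys Bs₁ Bs₂} → Args Δ₁ xs Bs₁ → Args Δ₂ ys Bs₂ →
           ∃ λ Δ → Args Δ (xs ++ ys) (Bs₁ ++ Bs₂) × Δ ≗ Δ₁ +ᶜ Δ₂
Args-++⁺ [] as₂ = _ , as₂ , λ _ → ≡.refl
Args-++⁺ {Δ₂ = Δ₂} (_∷_ {Γ} {Δ} d as₁) as₂ with _ , as , Δ≗ ← Args-++⁺ as₁ as₂ =
  _ , d ∷ as , λ n → ≡.trans (cong (Γ n ++_) (Δ≗ n)) (≡.sym (+ᶜ-assoc Γ Δ Δ₂ n))

HasType : Term → Ty → Set
HasType s B = Σ Ctx λ Δ → Derivable Δ s B

Args⇒HasType : ∀ {Δ ss Bs} → Args Δ ss Bs → Pointwise HasType ss Bs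
Args⇒HasType [] = []
Args⇒HasType (_∷_ {Γ} d as) = (Γ , Γ , _ , d , (λ _ → ≈ₘ-refl) , ≈ᵗ-refl) ∷ Args⇒HasType as

Match⇒≈ₘ : ∀ {j ss u Γ A Δ Bs} → Γ ⊢ u ∶ A → Args Δ ss Bs → Match j ss u → Γ j ≈ₘ Bs
Match⇒≈ₘ {j} d as (_ , ss∶Bs , fv≈) =
  trans (≡⇒≈ₘ (≡.sym (fvTypes-⊢ d j))) (trans fv≈ (refl (types≈ as ss∶Bs)))
  where
  types≈ : ∀ {Δ ss Bs Bs′} → Args Δ ss Bs → Pointwise HasType ss Bs′ → Pointwise _≈ᵗ_ Bs′ Bs
  types≈ [] [] = []
  types≈ (d ∷ as) ((_ , _ , _ , d′ , _ , B≈) ∷ ss∶Bs) with _ , ≡.refl ← ⊢-unique d d′ = B≈ ∷ types≈ as ss∶Bs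

record Typed (Γ : Ctx) (w : Term) (A : Ty) : Set where
  constructor typed
  field
    {ctx} : Ctx
    {ty} : Ty
    deriv : ctx ⊢ w ∶ ty
    ctx↭ : ctx ↭ᶜ Γ
    ty≈ : A ≈ᵗ ty

record TypedArgs (Δ : Ctx) (rs : List Term) (Bs : List Ty) : Set where
  constructor typedArgs
  field
    {ctx} : Ctx
    {tys} : List Ty
    args : Args ctx rs tys
    tys≈ : Pointwise _≈ᵗ_ Bs tys
    ctx↭ : ctx ↭ᶜ Δ

Typed⇒Derivable : ∀ {Γ Γ′ w A A′} → (∀ n → Γ n ≈ₘ Γ′ n) → A ≈ᵗ A′ → Typed Γ′ w A′ → Derivable Γ w A
Typed⇒Derivable Γ≈ A≈ (typed d ctx↭ A′≈) =
  _ , _ , d , (λ n → trans (Γ≈ n) (↭⇒≈ₘ (↭-sym (ctx↭ n)))) , ≈ᵗ-trans A≈ A′≈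

mutual
  -- The hypothesis on Γ j is needed only at the substituted variable; below an application the
  -- Match recorded in the Subst derivation supplies it.
  ⊢-subst : ∀ {j ss u r Γ A Δ Bs} → Subst j ss u r → Γ ⊢ u ∶ A → Args Δ ss Bs → Γ j ≈ₘ Bs →
            Typed (dropCtx j Γ +ᶜ Δ) r A
  ⊢-subst {j} (var-hit {A = A}) var (_∷_ {Δ} d []) A≈B
    with _ , ≡.refl , A≈ ← ≈ₘ-[-]-inv (≡.subst (_≈ₘ _) (single-self j (A ∷ [])) A≈B) =
    typed d (λ n → ↭-reflexive (≡.sym (cong₂ _++_ (dropCtx-single-≡ j (A ∷ []) n) (++-identityʳ (Δ n))))) A≈
  ⊢-subst {j} (var-lt {k} {A} k<j) var [] _ =
    typed var (λ n → ↭-reflexive (≡.sym (≡.trans (++-identityʳ _) (dropCtx-single-< j k (A ∷ []) k<j n))))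
          ≈ᵗ-refl
  ⊢-subst {j} (var-gt {k} {A} j<k) var [] _ =
    typed var (λ n → ↭-reflexive (≡.sym (≡.trans (++-identityʳ _) (dropCtx-single-> j k (A ∷ []) j<k n))))
          ≈ᵗ-refl
  ⊢-subst {j} (lam s) (lam {Γ} d) as Γ≈
    with _ , as′ , Δ′≗ ← Args-shift 0 as
    with typed dr ctx↭ B≈ ← ⊢-subst s d as′ Γ≈
    with at-zero , at-suc ← dropCtx-under-binder j Γ Δ′≗ =
    typed (lam dr) (λ n → ↭-trans (ctx↭ (suc n)) (↭-reflexive (at-suc n)))
          (arr (↭⇒≈ₘ (↭-sym (↭-trans (ctx↭ 0) (↭-reflexive at-zero)))) B≈)
  ⊢-subst {j} (app ss₀ _ ss↭ m s₀ sL) (app {Γ₀} {Δᵤ} d₀ das M≈) as _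
    with _ , _ , as′ , Δ↭ ← Args-↭ as ss↭
    with split a₀ aᵤ Δ′≗ ≡.refl ← Args-++⁻ ss₀ as′
    with typed dr₀ ctx₀ (arr M≈M′ A≈) ← ⊢-subst s₀ d₀ a₀ (Match⇒≈ₘ d₀ a₀ m)
    with typedArgs ars Bs≈ ctxᵤ ← ⊢-substL sL das aᵤ =
    typed (app dr₀ ars (trans (≈ₘ-sym M≈M′) (trans M≈ (refl Bs≈))))
          (↭ᶜ-trans (↭ᶜ-+ᶜ ctx₀ ctxᵤ) (↭ᶜ-sym (dropCtx-regroup j Γ₀ Δᵤ _ _ (↭ᶜ-trans Δ↭ (≗⇒↭ᶜ Δ′≗)))))
          A≈

  ⊢-substL : ∀ {j sss us rs Δᵤ Bs Δ Bs′} → SubstL j sss us rs → Args Δᵤ us Bs → Args Δ (concat sss) Bs′ →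
             TypedArgs (dropCtx j Δᵤ +ᶜ Δ) rs Bs
  ⊢-substL {j} [] [] [] = typedArgs [] [] λ n → ↭-reflexive (≡.sym (≡.trans (++-identityʳ _) (dropCtx-∅ j n)))
  ⊢-substL {j} (_∷_ {ss} (m , s) sL) (_∷_ {Γ} {Δᵤ} d das) as
    with split aₛ aᵤ Δ≗ ≡.refl ← Args-++⁻ ss as
    with typed dr ctx A≈ ← ⊢-subst s d aₛ (Match⇒≈ₘ d aₛ m)
    with typedArgs ars Bs≈ ctxᵤ ← ⊢-substL sL das aᵤ =
    typedArgs (dr ∷ ars) (A≈ ∷ Bs≈) (↭ᶜ-trans (↭ᶜ-+ᶜ ctx ctxᵤ) (↭ᶜ-sym (dropCtx-regroup j Γ Δᵤ _ _ (≗⇒↭ᶜ Δ≗))))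

⊢-β : ∀ {Γ A l t ss r} → Γ ⊢ app (lam l t) ss ∶ A → Subst 0 ss t r → Typed Γ r A
⊢-β (app (lam dt) as M≈) s = ⊢-subst s dt as M≈

HasType-resp-≈ᵗ : ∀ {s B C} → B ≈ᵗ C → HasType s B → HasType s C
HasType-resp-≈ᵗ B≈C (Δ , Γ , A , d , Δ≈ , B≈A) = Δ , Γ , A , d , Δ≈ , ≈ᵗ-trans (≈ᵗ-sym B≈C) B≈A

HasType-shift : ∀ {s B} c → HasType s B → HasType (shift c s) B
HasType-shift c (_ , _ , A , d , _ , B≈A) with Γ′ , d′ , _ ← ⊢-shift c d =
  Γ′ , Γ′ , A , d′ , (λ _ → ≈ₘ-refl) , B≈A

Pointwise-HasType-shift : ∀ {ss Bs} c → Pointwise HasType ss Bs → Pointwise HasType (shiftL c ss) Bs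
Pointwise-HasType-shift c [] = []
Pointwise-HasType-shift c (h ∷ hs) = HasType-shift c h ∷ Pointwise-HasType-shift c hs

Pointwise-HasType-≈ₘ : ∀ {ss Bs Cs} → Pointwise HasType ss Bs → Bs ≈ₘ Cs →
                       ∃ λ ss′ → ss ↭ ss′ × Pointwise HasType ss′ Cs
Pointwise-HasType-≈ₘ hs (refl Bs≋Cs) = _ , ↭-refl , PW.respʳ HasType-resp-≈ᵗ Bs≋Cs hs
Pointwise-HasType-≈ₘ (h ∷ hs) (prep B≈C p) with _ , ss↭ , hs′ ← Pointwise-HasType-≈ₘ hs p =
  _ , ↭.prep _ ss↭ , HasType-resp-≈ᵗ B≈C h ∷ hs′
Pointwise-HasType-≈ₘ (h₁ ∷ h₂ ∷ hs) (swap B₁≈C₂ B₂≈C₁ p) with _ , ss↭ , hs′ ← Pointwise-HasType-≈ₘ hs p =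
  _ , ↭.swap _ _ ss↭ , HasType-resp-≈ᵗ B₂≈C₁ h₂ ∷ HasType-resp-≈ᵗ B₁≈C₂ h₁ ∷ hs′
Pointwise-HasType-≈ₘ hs (trans p q)
  with _ , ss↭ , hs′ ← Pointwise-HasType-≈ₘ hs p
  with _ , ss′↭ , hs″ ← Pointwise-HasType-≈ₘ hs′ q = _ , ↭-trans ss↭ ss′↭ , hs″

Pointwise-++⁻ : ∀ {A B : Set} {R : A → B → Set} Bs {Cs ss} → Pointwise R ss (Bs ++ Cs) →
                ∃₂ λ ss₁ ss₂ → ss ≡ ss₁ ++ ss₂ × Pointwise R ss₁ Bs × Pointwise R ss₂ Cs
Pointwise-++⁻ [] rs = [] , _ , ≡.refl , [] , rs
Pointwise-++⁻ (B ∷ Bs) (r ∷ rs) with _ , _ , ≡.refl , rs₁ , rs₂ ← Pointwise-++⁻ Bs rs =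
  _ , _ , ≡.refl , r ∷ rs₁ , rs₂

mutual
  Subst-total : ∀ j u ss → Match j ss u → ∃ (Subst j ss u)
  Subst-total j (var k A) ss (_ , _ , fv≈) with k ≡ᵇ j in k≡ᵇj
  Subst-total j (var k A) ss (_ , _ , fv≈) | true with ≈ₘ-[-]-inv fv≈
  Subst-total j (var k A) (s ∷ []) (_ , _ ∷ [] , _) | true | _ , ≡.refl , _
    with ≡.refl ← ≡ᵇ⇒≡ k j (≡.subst T (≡.sym k≡ᵇj) _) = s , var-hit
  Subst-total j (var k A) ss (_ , _ , fv≈) | false with ≈ₘ-[]-inv fv≈
  Subst-total j (var k A) [] (_ , [] , _) | false | ≡.refl with <-cmp k j
  ... | tri< k<j _ _ = _ , var-lt k<j
  ... | tri≈ _ ≡.refl _ = contradiction (≡.trans (≡.sym (≡ᵇ-refl k)) k≡ᵇj) λ ()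
  ... | tri> _ _ j<k = _ , var-gt j<k
  Subst-total j (lam l u) ss (Bs , ss∶Bs , fv≈)
    with r , s ← Subst-total (suc j) u (shiftL 0 ss) (Bs , Pointwise-HasType-shift 0 ss∶Bs , fv≈) =
    lam l r , lam s
  Subst-total j (app u us) ss (_ , ss∶Bs , fv≈)
    with _ , ss↭ , ss∶fv ← Pointwise-HasType-≈ₘ ss∶Bs (≈ₘ-sym fv≈)
    with ss₀ , ssᵤ , ≡.refl , ss₀∶ , ssᵤ∶ ← Pointwise-++⁻ (fvTypes j u) ss∶fv
    with r , s ← Subst-total j u ss₀ (_ , ss₀∶ , ≈ₘ-refl)
    with sss , rs , ≡.refl , sL ← SubstL-total j us ssᵤ ssᵤ∶ =
    app r rs , app ss₀ sss ss↭ (_ , ss₀∶ , ≈ₘ-refl) s sL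

  SubstL-total : ∀ j us ss → Pointwise HasType ss (fvTypesL j us) →
                 ∃₂ λ sss rs → ss ≡ concat sss × SubstL j sss us rs
  SubstL-total j [] [] [] = [] , [] , ≡.refl , []
  SubstL-total j (u ∷ us) ss ss∶fv
    with ss₀ , ssᵤ , ≡.refl , ss₀∶ , ssᵤ∶ ← Pointwise-++⁻ (fvTypes j u) ss∶fv
    with r , s ← Subst-total j u ss₀ (_ , ss₀∶ , ≈ₘ-refl)
    with sss , rs , ≡.refl , sL ← SubstL-total j us ssᵤ ssᵤ∶ =
    ss₀ ∷ sss , r ∷ rs , ≡.refl , ((_ , ss₀∶ , ≈ₘ-refl) , s) ∷ sL

Match-β : ∀ {Γ A l t ss} → Γ ⊢ app (lam l t) ss ∶ A → Match 0 ss t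
Match-β (app (lam dt) as M≈) = _ , Args⇒HasType as , trans (≡⇒≈ₘ (fvTypes-⊢ dt 0)) M≈

-- Correctness

-- Correct t unfolds to Typable t × Unique (lamLabels t) × SubtermsCorrect t.
LocallyCorrect : Term → Set
LocallyCorrect w = ∀ Γ A → Derivable Γ w A →
  SeqCtx Γ ×
  (∀ M l B → (Σ ℕ (λ x → Any (arr M l B ⊴_) (Γ x)) ⊎ (arr M l B ⊴ A)) → Sequential M)

SubtermsCorrect : Term → Set
SubtermsCorrect t = ∀ w → w ⊑ t → LocallyCorrect w

record SequentialJudgement (Γ : Ctx) (A : Ty) : Set where
  constructor seqJ
  field
    seqCtx : SeqCtx Γ
    deepCtx : ∀ x → DeepSeqs (Γ x)
    deepTy : DeepSeq A

SequentialJudgement-resp : ∀ {Γ Γ′ A A′} → (∀ x → Γ x ≈ₘ Γ′ x) → A ≈ᵗ A′ →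
                           SequentialJudgement Γ A → SequentialJudgement Γ′ A′
SequentialJudgement-resp Γ≈ A≈ (seqJ sq dΓ dA) =
  seqJ (λ x → Sequential-resp-≈ₘ (Γ≈ x) (sq x)) (λ x → DeepSeqs-resp-≈ₘ (Γ≈ x) (dΓ x)) (DeepSeq-resp-≈ᵗ A≈ dA)

LocallyCorrect-intro : ∀ {Γ w A} → Γ ⊢ w ∶ A → SequentialJudgement Γ A → LocallyCorrect w
LocallyCorrect-intro d sj Γ′ A′ (_ , _ , d′ , Γ′≈ , A′≈) with Γ≗ , ≡.refl ← ⊢-unique d d′ =
  seqCtx , λ { M l B (inj₁ (x , h)) → DeepSeqs⇒ArrowsSequentialᴸ (deepCtx x) M l B h
             ; M l B (inj₂ h) → DeepSeq⇒ArrowsSequential deepTy M l B h }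
  where
  open SequentialJudgement
    (SequentialJudgement-resp (λ x → trans (≡⇒≈ₘ (Γ≗ x)) (≈ₘ-sym (Γ′≈ x))) (≈ᵗ-sym A′≈) sj)

LocallyCorrect-elim : ∀ {Γ w A} → LocallyCorrect w → Γ ⊢ w ∶ A → SequentialJudgement Γ A
LocallyCorrect-elim {Γ} {A = A} lc d with sq , seq ← lc Γ A (Γ , A , d , (λ _ → ≈ₘ-refl) , ≈ᵗ-refl) =
  seqJ sq (λ x → ArrowsSequentialᴸ⇒DeepSeqs (Γ x) λ M l B h → seq M l B (inj₁ (x , h)))
          (ArrowsSequential⇒DeepSeq A λ M l B h → seq M l B (inj₂ h))

LocallyCorrect-transfer : ∀ {Γ w A w′} → Γ ⊢ w ∶ A → Typed Γ w′ A → LocallyCorrect w → LocallyCorrect w′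
LocallyCorrect-transfer d (typed d′ ctx↭ A≈) lc =
  LocallyCorrect-intro d′ (SequentialJudgement-resp (λ x → ↭⇒≈ₘ (↭-sym (ctx↭ x))) A≈ (LocallyCorrect-elim lc d))

SubtermsCorrect-var⁺ : ∀ {k A} → LocallyCorrect (var k A) → SubtermsCorrect (var k A)
SubtermsCorrect-var⁺ lc _ refl = lc

SubtermsCorrect-lam⁻ : ∀ {l t} → SubtermsCorrect (lam l t) → SubtermsCorrect t
SubtermsCorrect-lam⁻ sc w w⊑ = sc w (inLam w⊑)

SubtermsCorrect-lam⁺ : ∀ {l t} → LocallyCorrect (lam l t) → SubtermsCorrect t → SubtermsCorrect (lam l t)
SubtermsCorrect-lam⁺ lc sc _ refl = lc
SubtermsCorrect-lam⁺ lc sc w (inLam w⊑) = sc w w⊑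

SubtermsCorrect-app⁻ : ∀ {t us} → SubtermsCorrect (app t us) → SubtermsCorrect t × All SubtermsCorrect us
SubtermsCorrect-app⁻ sc =
  (λ w w⊑ → sc w (inFun w⊑)) , All.tabulate λ u∈ w w⊑ → sc w (inArg (Any.map ≡.sym u∈) w⊑)

SubtermsCorrect-app⁺ : ∀ {t us} → LocallyCorrect (app t us) → SubtermsCorrect t → All SubtermsCorrect us →
                       SubtermsCorrect (app t us)
SubtermsCorrect-app⁺ lc sc scs _ refl = lc
SubtermsCorrect-app⁺ lc sc scs w (inFun w⊑) = sc w w⊑
SubtermsCorrect-app⁺ lc sc scs w (inArg u∈ w⊑) = All.lookup scs (Any.map ≡.sym u∈) w w⊑

LocallyCorrect-shift : ∀ {Γ w A} c → Γ ⊢ w ∶ A → LocallyCorrect w → LocallyCorrect (shift c w)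
LocallyCorrect-shift c d lc
  with _ , d′ , Γ′≗ ← ⊢-shift c d
  with seqJ sq dΓ dA ← LocallyCorrect-elim lc d =
  LocallyCorrect-intro d′
    (seqJ (λ n → ≡.subst Sequential (≡.sym (Γ′≗ n)) (shiftCtx-preserves Sequential c [] sq n))
          (λ n → ≡.subst DeepSeqs (≡.sym (Γ′≗ n)) (shiftCtx-preserves DeepSeqs c [] dΓ n))
          dA)

⊑-shift-var : ∀ {w} c k A → w ⊑ shift c (var k A) → w ≡ shift c (var k A)
⊑-shift-var c k A w⊑ with k <ᵇ c
... | true with refl ← w⊑ = ≡.refl
... | false with refl ← w⊑ = ≡.refl

∈-shiftL : ∀ c ss {u} → Any (_≡ u) (shiftL c ss) → ∃ λ s → Any (_≡ s) ss × u ≡ shift c s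
∈-shiftL c (s ∷ ss) (here ≡.refl) = s , here ≡.refl , ≡.refl
∈-shiftL c (s ∷ ss) (there u∈) with s′ , s′∈ , ≡.refl ← ∈-shiftL c ss u∈ = s′ , there s′∈ , ≡.refl

⊑-shift : ∀ c s {w} → w ⊑ shift c s → ∃₂ λ c′ w₀ → w₀ ⊑ s × w ≡ shift c′ w₀
⊑-shift c (var k A) w⊑ = c , var k A , refl , ⊑-shift-var c k A w⊑
⊑-shift c (lam l t) refl = c , lam l t , refl , ≡.refl
⊑-shift c (lam l t) (inLam w⊑) with c′ , w₀ , w₀⊑ , ≡.refl ← ⊑-shift (suc c) t w⊑ =
  c′ , w₀ , inLam w₀⊑ , ≡.refl
⊑-shift c (app t ss) refl = c , app t ss , refl , ≡.refl
⊑-shift c (app t ss) (inFun w⊑) with c′ , w₀ , w₀⊑ , ≡.refl ← ⊑-shift c t w⊑ =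
  c′ , w₀ , inFun w₀⊑ , ≡.refl
⊑-shift c (app t ss) (inArg u∈ w⊑)
  with s , s∈ , ≡.refl ← ∈-shiftL c ss u∈
  with c′ , w₀ , w₀⊑ , ≡.refl ← ⊑-shift c s w⊑ = c′ , w₀ , inArg s∈ w₀⊑ , ≡.refl

SubtermsCorrect-shift : ∀ {Γ s A} c → Γ ⊢ s ∶ A → SubtermsCorrect s → SubtermsCorrect (shift c s)
SubtermsCorrect-shift c d sc w w⊑
  with c′ , w₀ , w₀⊑ , ≡.refl ← ⊑-shift c _ w⊑
  with _ , _ , d₀ ← ⊢-⊑ d w₀⊑ = LocallyCorrect-shift c′ d₀ (sc w₀ w₀⊑)

All-SubtermsCorrect-shift : ∀ {Δ ss Bs} c → Args Δ ss Bs → All SubtermsCorrect ss →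
                            All SubtermsCorrect (shiftL c ss)
All-SubtermsCorrect-shift c [] [] = []
All-SubtermsCorrect-shift c (d ∷ as) (sc ∷ scs) =
  SubtermsCorrect-shift c d sc ∷ All-SubtermsCorrect-shift c as scs

Args-deepCtx : ∀ {Δ ss Bs} → Args Δ ss Bs → All SubtermsCorrect ss → ∀ n → DeepSeqs (Δ n)
Args-deepCtx [] [] n = []
Args-deepCtx (d ∷ as) (sc ∷ scs) n =
  All.++⁺ (SequentialJudgement.deepCtx (LocallyCorrect-elim (sc _ refl) d) n) (Args-deepCtx as scs n)

LocallyCorrect-subst : ∀ {j ss u r Γ A Δ Bs} → Subst j ss u r → Γ ⊢ u ∶ A → Args Δ ss Bs → Γ j ≈ₘ Bs →
                       SubtermsCorrect u → All SubtermsCorrect ss → SeqCtx (dropCtx j Γ +ᶜ Δ) →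
                       LocallyCorrect r
LocallyCorrect-subst {j} s d as Γ≈ scu scs sq
  with typed dr ctx↭ A≈ ← ⊢-subst s d as Γ≈
  with seqJ _ dΓ dA ← LocallyCorrect-elim (scu _ refl) d =
  LocallyCorrect-intro dr (SequentialJudgement-resp (λ n → ↭⇒≈ₘ (↭-sym (ctx↭ n))) A≈
    (seqJ sq (λ n → All.++⁺ (dropCtx-preserves DeepSeqs j dΓ n) (Args-deepCtx as scs n)) dA))

mutual
  SubtermsCorrect-subst : ∀ {j ss u r Γ A Δ Bs} → Subst j ss u r → Γ ⊢ u ∶ A → Args Δ ss Bs → Γ j ≈ₘ Bs →
                          SubtermsCorrect u → All SubtermsCorrect ss → SeqCtx (dropCtx j Γ +ᶜ Δ) →
                          SubtermsCorrect r
  SubtermsCorrect-subst var-hit _ (_ ∷ []) _ _ (sc ∷ []) _ = sc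
  SubtermsCorrect-subst s@(var-lt _) d as Γ≈ scu scs sq =
    SubtermsCorrect-var⁺ (LocallyCorrect-subst s d as Γ≈ scu scs sq)
  SubtermsCorrect-subst s@(var-gt _) d as Γ≈ scu scs sq =
    SubtermsCorrect-var⁺ (LocallyCorrect-subst s d as Γ≈ scu scs sq)
  SubtermsCorrect-subst {j} s@(lam s′) (lam {Γ} d) as Γ≈ scu scs sq
    with Δ′ , as′ , Δ′≗ ← Args-shift 0 as
    with at-zero , at-suc ← dropCtx-under-binder j Γ Δ′≗ =
    SubtermsCorrect-lam⁺ (LocallyCorrect-subst s (lam d) as Γ≈ scu scs sq)
      (SubtermsCorrect-subst s′ d as′ Γ≈ (SubtermsCorrect-lam⁻ scu) (All-SubtermsCorrect-shift 0 as scs) sq′)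
    where
    sq′ : SeqCtx (dropCtx (suc j) Γ +ᶜ Δ′)
    sq′ zero = ≡.subst Sequential (≡.sym at-zero)
                 (SequentialJudgement.seqCtx (LocallyCorrect-elim (scu _ (inLam refl)) d) 0)
    sq′ (suc n) = ≡.subst Sequential (≡.sym (at-suc n)) (sq n)
  SubtermsCorrect-subst {j} s@(app ss₀ sss ss↭ m s₀ sL) d@(app {Γ₀} {Δᵤ} d₀ das _) as Γ≈ scu scs sq
    with _ , _ , as′ , Δ↭ ← Args-↭ as ss↭
    with split a₀ aᵤ Δ′≗ ≡.refl ← Args-++⁻ ss₀ as′
    with scu₀ , scsᵤ ← SubtermsCorrect-app⁻ scu
    with sq₀ , sqᵤ ← SeqCtx-split _ _ (dropCtx-regroup j Γ₀ Δᵤ _ _ (↭ᶜ-trans Δ↭ (≗⇒↭ᶜ Δ′≗))) sq =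
    SubtermsCorrect-app⁺ (LocallyCorrect-subst s d as Γ≈ scu scs sq)
      (SubtermsCorrect-subst s₀ d₀ a₀ (Match⇒≈ₘ d₀ a₀ m) scu₀ (All.++⁻ˡ ss₀ scs′) sq₀)
      (SubtermsCorrect-substL sL das aᵤ scsᵤ (All.++⁻ʳ ss₀ scs′) sqᵤ)
    where
    scs′ : All SubtermsCorrect (ss₀ ++ concat sss)
    scs′ = All-resp-↭ ss↭ scs

  SubtermsCorrect-substL : ∀ {j sss us rs Δᵤ Bs Δ Bs′} → SubstL j sss us rs →
                           Args Δᵤ us Bs → Args Δ (concat sss) Bs′ →
                           All SubtermsCorrect us → All SubtermsCorrect (concat sss) →
                           SeqCtx (dropCtx j Δᵤ +ᶜ Δ) → All SubtermsCorrect rs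
  SubtermsCorrect-substL [] [] [] [] [] _ = []
  SubtermsCorrect-substL {j} (_∷_ {ss} (m , s) sL) (_∷_ {Γ} {Δᵤ} d das) as (scu ∷ scus) scs sq
    with split aₛ aᵤ Δ≗ ≡.refl ← Args-++⁻ ss as
    with sqₛ , sqᵤ ← SeqCtx-split _ _ (dropCtx-regroup j Γ Δᵤ _ _ (≗⇒↭ᶜ Δ≗)) sq =
    SubtermsCorrect-subst s d aₛ (Match⇒≈ₘ d aₛ m) scu (All.++⁻ˡ ss scs) sqₛ ∷
    SubtermsCorrect-substL sL das aᵤ scus (All.++⁻ʳ ss scs) sqᵤ

SubtermsCorrect-β : ∀ {Γ A l t ss r} → Γ ⊢ app (lam l t) ss ∶ A → Subst 0 ss t r →
                    SubtermsCorrect (app (lam l t) ss) → SubtermsCorrect r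
SubtermsCorrect-β d@(app (lam dt) as M≈) s sc with sct , scs ← SubtermsCorrect-app⁻ sc =
  SubtermsCorrect-subst s dt as M≈ (SubtermsCorrect-lam⁻ sct) scs
    (SequentialJudgement.seqCtx (LocallyCorrect-elim (sc _ refl) d))

-- One-hole contexts and lambda labels

plug-⊑ : ∀ C x → x ⊑ plug C x
plug-⊑ □ x = refl
plug-⊑ (lam l C) x = inLam (plug-⊑ C x)
plug-⊑ (appL C ss) x = inFun (plug-⊑ C x)
plug-⊑ (appR u ss₁ C ss₂) x = inArg (Any.++⁺ʳ ss₁ (here ≡.refl)) (plug-⊑ C x)

⊢-plug : ∀ C {x y} → (∀ {Γ A} → Γ ⊢ x ∶ A → Typed Γ y A) →
         ∀ {Γ A} → Γ ⊢ plug C x ∶ A → Typed Γ (plug C y) A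
⊢-plug □ x⇒y d = x⇒y d
⊢-plug (lam l C) x⇒y (lam d) with typed d′ ctx↭ B≈ ← ⊢-plug C x⇒y d =
  typed (lam d′) (ctx↭ ∘ suc) (arr (↭⇒≈ₘ (↭-sym (ctx↭ 0))) B≈)
⊢-plug (appL C ss) x⇒y (app d as M≈) with typed d′ ctx↭ (arr M≈M′ A≈) ← ⊢-plug C x⇒y d =
  typed (app d′ as (trans (≈ₘ-sym M≈M′) M≈)) (↭ᶜ-+ᶜ ctx↭ ↭ᶜ-refl) A≈
⊢-plug (appR u ss₁ C ss₂) x⇒y (app du as M≈)
  with split {Δˡ} aˡ (_∷_ {Δ = Δʳ} dx aʳ) Δ≗ ≡.refl ← Args-++⁻ ss₁ as
  with typed d′ ctx↭ B≈ ← ⊢-plug C x⇒y dx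
  with _ , as′ , Δ′≗ ← Args-++⁺ aˡ (d′ ∷ aʳ) =
  typed (app du as′ (trans M≈ (refl (PW.++⁺ ≋ᵗ-refl (B≈ ∷ ≋ᵗ-refl)))))
        (↭ᶜ-+ᶜ ↭ᶜ-refl (↭ᶜ-trans (≗⇒↭ᶜ Δ′≗)
          (↭ᶜ-trans (↭ᶜ-+ᶜ (↭ᶜ-refl {Δˡ}) (↭ᶜ-+ᶜ ctx↭ (↭ᶜ-refl {Δʳ}))) (↭ᶜ-sym (≗⇒↭ᶜ Δ≗)))))
        ≈ᵗ-refl

SubtermsCorrect-plug : ∀ C {x y} → (∀ {Γ A} → Γ ⊢ x ∶ A → Typed Γ y A) →
                       (∀ {Γ A} → Γ ⊢ x ∶ A → SubtermsCorrect x → SubtermsCorrect y) →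
                       ∀ {Γ A} → Γ ⊢ plug C x ∶ A → SubtermsCorrect (plug C x) → SubtermsCorrect (plug C y)
SubtermsCorrect-plug □ _ sc⇒ d sc = sc⇒ d sc
SubtermsCorrect-plug C@(lam _ C′) x⇒y sc⇒ d@(lam d′) sc =
  SubtermsCorrect-lam⁺ (LocallyCorrect-transfer d (⊢-plug C x⇒y d) (sc _ refl))
    (SubtermsCorrect-plug C′ x⇒y sc⇒ d′ (SubtermsCorrect-lam⁻ sc))
SubtermsCorrect-plug C@(appL C′ _) x⇒y sc⇒ d@(app d′ _ _) sc with scf , scs ← SubtermsCorrect-app⁻ sc =
  SubtermsCorrect-app⁺ (LocallyCorrect-transfer d (⊢-plug C x⇒y d) (sc _ refl))
    (SubtermsCorrect-plug C′ x⇒y sc⇒ d′ scf) scs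
SubtermsCorrect-plug C@(appR _ ss₁ C′ _) x⇒y sc⇒ d@(app _ as _) sc
  with scf , scs ← SubtermsCorrect-app⁻ sc
  with split _ (dx ∷ _) _ ≡.refl ← Args-++⁻ ss₁ as
  with scx ∷ scs₂ ← All.++⁻ʳ ss₁ scs =
  SubtermsCorrect-app⁺ (LocallyCorrect-transfer d (⊢-plug C x⇒y d) (sc _ refl)) scf
    (All.++⁺ (All.++⁻ˡ ss₁ scs) (SubtermsCorrect-plug C′ x⇒y sc⇒ dx scx ∷ scs₂))

mutual
  lamLabels-shift : ∀ c s → lamLabels (shift c s) ≡ lamLabels s
  lamLabels-shift c (var k A) with k <ᵇ c
  ... | true = ≡.refl
  ... | false = ≡.refl
  lamLabels-shift c (lam l t) = cong (l ∷_) (lamLabels-shift (suc c) t)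
  lamLabels-shift c (app t ss) = cong₂ _++_ (lamLabels-shift c t) (lamLabelsL-shift c ss)

  lamLabelsL-shift : ∀ c ss → lamLabelsL (shiftL c ss) ≡ lamLabelsL ss
  lamLabelsL-shift c [] = ≡.refl
  lamLabelsL-shift c (s ∷ ss) = cong₂ _++_ (lamLabels-shift c s) (lamLabelsL-shift c ss)

lamLabelsL-++ : ∀ xs ys → lamLabelsL (xs ++ ys) ≡ lamLabelsL xs ++ lamLabelsL ys
lamLabelsL-++ [] ys = ≡.refl
lamLabelsL-++ (x ∷ xs) ys =
  ≡.trans (cong (lamLabels x ++_) (lamLabelsL-++ xs ys)) (≡.sym (++-assoc (lamLabels x) _ _))

lamLabelsL-↭ : ∀ {xs ys} → xs ↭ ys → lamLabelsL xs ↭ lamLabelsL ys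
lamLabelsL-↭ ↭.refl = ↭-refl
lamLabelsL-↭ (↭.prep x p) = ++⁺ˡ (lamLabels x) (lamLabelsL-↭ p)
lamLabelsL-↭ (↭.swap x y p) =
  ↭-trans (++⁺ˡ (lamLabels x) (++⁺ˡ (lamLabels y) (lamLabelsL-↭ p))) (shifts (lamLabels x) (lamLabels y))
lamLabelsL-↭ (↭.trans p q) = ↭-trans (lamLabelsL-↭ p) (lamLabelsL-↭ q)

mutual
  lamLabels-subst : ∀ {j ss u r} → Subst j ss u r → lamLabels r ↭ lamLabels u ++ lamLabelsL ss
  lamLabels-subst (var-hit {s}) = ↭-reflexive (≡.sym (++-identityʳ (lamLabels s)))
  lamLabels-subst (var-lt _) = ↭-refl
  lamLabels-subst (var-gt _) = ↭-refl
  lamLabels-subst {ss = ss} (lam {l = l} {u = u} s) =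
    ↭.prep l (↭-trans (lamLabels-subst s) (↭-reflexive (cong (lamLabels u ++_) (lamLabelsL-shift 0 ss))))
  lamLabels-subst {ss = ss} (app {u0 = u} {us} {r0 = r} {rs} ss₀ sss ss↭ _ s sL) = begin
    lamLabels r ++ lamLabelsL rs      ↭⟨ ++⁺ (lamLabels-subst s) (lamLabels-substL sL) ⟩
    (U ++ S₀) ++ (Us ++ Sᶜ)           ↭⟨ interchange U S₀ Us Sᶜ ⟩
    (U ++ Us) ++ (S₀ ++ Sᶜ)           ≡⟨ cong ((U ++ Us) ++_) (lamLabelsL-++ ss₀ (concat sss)) ⟨
    (U ++ Us) ++ lamLabelsL (ss₀ ++ concat sss) ↭⟨ ++⁺ˡ (U ++ Us) (lamLabelsL-↭ (↭-sym ss↭)) ⟩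
    (U ++ Us) ++ lamLabelsL ss        ∎
    where
    open ↭.PermutationReasoning
    U S₀ Us Sᶜ : List Label
    U = lamLabels u
    S₀ = lamLabelsL ss₀
    Us = lamLabelsL us
    Sᶜ = lamLabelsL (concat sss)

  lamLabels-substL : ∀ {j sss us rs} → SubstL j sss us rs →
                     lamLabelsL rs ↭ lamLabelsL us ++ lamLabelsL (concat sss)
  lamLabels-substL [] = ↭-refl
  lamLabels-substL (_∷_ {ss} {sss} {u} {us} {r} {rs} (_ , s) sL) = begin
    lamLabels r ++ lamLabelsL rs      ↭⟨ ++⁺ (lamLabels-subst s) (lamLabels-substL sL) ⟩
    (U ++ S) ++ (Us ++ Sᶜ)            ↭⟨ interchange U S Us Sᶜ ⟩
    (U ++ Us) ++ (S ++ Sᶜ)            ≡⟨ cong ((U ++ Us) ++_) (lamLabelsL-++ ss (concat sss)) ⟨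
    (U ++ Us) ++ lamLabelsL (ss ++ concat sss) ∎
    where
    open ↭.PermutationReasoning
    U S Us Sᶜ : List Label
    U = lamLabels u
    S = lamLabelsL ss
    Us = lamLabelsL us
    Sᶜ = lamLabelsL (concat sss)

lamLabels-β : ∀ {l t ss r} → Subst 0 ss t r → lamLabels (app (lam l t) ss) ↭ lamLabels r ++ l ∷ []
lamLabels-β {l} {r = r} s = ↭-trans (↭.prep l (↭-sym (lamLabels-subst s))) (∷↭∷ʳ l (lamLabels r))

holeLabels : Hole → List Label
holeLabels □ = []
holeLabels (lam l C) = l ∷ holeLabels C
holeLabels (appL C ss) = holeLabels C ++ lamLabelsL ss
holeLabels (appR u ss₁ C ss₂) = lamLabels u ++ (lamLabelsL ss₁ ++ (holeLabels C ++ lamLabelsL ss₂))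

lamLabels-plug : ∀ C x → lamLabels (plug C x) ↭ holeLabels C ++ lamLabels x
lamLabels-plug □ x = ↭-refl
lamLabels-plug (lam l C) x = ↭.prep l (lamLabels-plug C x)
lamLabels-plug (appL C ss) x =
  ↭-trans (++⁺ʳ (lamLabelsL ss) (lamLabels-plug C x))
          (xy∙z≈xz∙y (holeLabels C) (lamLabels x) (lamLabelsL ss))
lamLabels-plug (appR u ss₁ C ss₂) x = begin
  U ++ lamLabelsL (ss₁ ++ plug C x ∷ ss₂)        ≡⟨ cong (U ++_) (lamLabelsL-++ ss₁ _) ⟩
  U ++ (L₁ ++ (lamLabels (plug C x) ++ L₂))      ↭⟨ ++⁺ˡ U (++⁺ˡ L₁ (++⁺ʳ L₂ (lamLabels-plug C x))) ⟩
  U ++ (L₁ ++ ((holeLabels C ++ X) ++ L₂))       ↭⟨ ++⁺ˡ U (++⁺ˡ L₁ (xy∙z≈xz∙y _ X L₂)) ⟩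
  U ++ (L₁ ++ ((holeLabels C ++ L₂) ++ X))       ≡⟨ cong (U ++_) (++-assoc L₁ _ X) ⟨
  U ++ ((L₁ ++ (holeLabels C ++ L₂)) ++ X)       ≡⟨ ++-assoc U _ X ⟨
  holeLabels (appR u ss₁ C ss₂) ++ X             ∎
  where
  open ↭.PermutationReasoning
  U L₁ L₂ X : List Label
  U = lamLabels u
  L₁ = lamLabelsL ss₁
  L₂ = lamLabelsL ss₂
  X = lamLabels x

Unique-lamLabels-plug : ∀ C {x y} zs → lamLabels x ↭ lamLabels y ++ zs →
                        Unique (lamLabels (plug C x)) → Unique (lamLabels (plug C y))
Unique-lamLabels-plug C {x} {y} zs x↭y u =
  Unique-resp-↭ (↭-sym (lamLabels-plug C y)) (Unique-++⁻ˡ _ (Unique-resp-↭ plug-x↭ u))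
  where
  open ↭.PermutationReasoning
  plug-x↭ : lamLabels (plug C x) ↭ (holeLabels C ++ lamLabels y) ++ zs
  plug-x↭ = begin
    lamLabels (plug C x)                 ↭⟨ lamLabels-plug C x ⟩
    holeLabels C ++ lamLabels x          ↭⟨ ++⁺ˡ (holeLabels C) x↭y ⟩
    holeLabels C ++ (lamLabels y ++ zs)  ≡⟨ ++-assoc (holeLabels C) (lamLabels y) zs ⟨
    (holeLabels C ++ lamLabels y) ++ zs  ∎

lemma1 : ∀ (C : Hole) (l : Label) (t : Term) (ss : List Term) (Γ : Ctx) (A : Ty) →
    Correct (plug C (app (lam l t) ss)) →
    Derivable Γ (plug C (app (lam l t) ss)) A →
    (Σ Term λ r → t [ 0 ≔ ss ]≐ r) ×
    (∀ r → t [ 0 ≔ ss ]≐ r → Correct (plug C r) × Derivable Γ (plug C r) A)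
lemma1 C l t ss Γ A (_ , labels-unique , sc) (Γ′ , A′ , d , Γ≈ , A≈)
  with _ , _ , d-redex ← ⊢-⊑ d (plug-⊑ C (app (lam l t) ss)) =
  (let r , s = Subst-total 0 t ss (Match-β d-redex) in r , Match-β d-redex , s) , reduct
  where
  reduct : ∀ r → t [ 0 ≔ ss ]≐ r → Correct (plug C r) × Derivable Γ (plug C r) A
  reduct r (_ , s) =
    ((_ , _ , Typed⇒Derivable (λ _ → ≈ₘ-refl) ≈ᵗ-refl typed-r) ,
     Unique-lamLabels-plug C (l ∷ []) (lamLabels-β s) labels-unique ,
     SubtermsCorrect-plug C (λ dx → ⊢-β dx s) (λ dx → SubtermsCorrect-β dx s) d sc) ,
    Typed⇒Derivable Γ≈ A≈ typed-r
    where
    typed-r : Typed Γ′ (plug C r) A′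
    typed-r = ⊢-plug C (λ dx → ⊢-β dx s) d
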